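{- Let $G,G'$ be finite node-labeled digraphs that are weakly connected, simple and oriented. If $\mathcal L(G)\cong\mathcal L(G')$, then $S(G)\cong S(G')$.
   Context: A node-labeled digraph $G=(V,\mathcal D,\ell_v)$ consists of a finite node set $V$, directed edges $\mathcal D\subseteq V\times V$, and a node-labeling function $\ell_v$. Weakly connected: underlying undirected graph connected. Simple: no self-loops and no parallel edges with the same source and target. Oriented: no pair $(u,v),(v,u)$ both in $\mathcal D$. The structure $S(G)$ is the unlabeled undirected graph on $V$ with edges $\{u,v\}$ for $(u,v)\in\mathcal D$; $S(G)\cong S(G')$ is isomorphism of unlabeled undirected graphs. Isomorphism of labeled digraphs: a node-label-preserving bijection of node sets with edges mapping to edges and non-edges to non-edges, preserving edge labels. The extended line digraph of $G$ is the labeled digraph $\mathcal L(G)=(\mathcal D,\mathcal D_L,\bar\ell_v,\bar\ell_e)$ with node set $\mathcal D$, node labels $\bar\ell_v((u,v))=(\ell_v(u),\ell_v(v))$, and, for distinct $e=(u,v),\hat e=(\hat u,\hat v)\in\mathcal D$: $(e,\hat e)\in\mathcal D_L$ labeled $ht$ iff $v=\hat u$; $(e,\hat e),(\hat e,e)\in\mathcal D_L$ labeled $tt$ iff $u=\hat u$; $(e,\hat e),(\hat e,e)\in\mathcal D_L$ labeled $hh$ iff $v=\hat v$. -}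

module Defs where

open import Data.Nat using (ℕ)
open import Data.Fin using (Fin)
open import Data.Bool using (Bool; true; false)
open import Data.Product using (Σ; _×_; _,_; proj₁; proj₂; ∃)
open import Data.Sum using (_⊎_)
open import Function using (_⇔_; _↔_; Inverse)
open import Relation.Binary.PropositionalEquality using (_≡_; _≢_)
open import Relation.Binary.Construct.Closure.ReflexiveTransitive using (Star)
open import Level using (Level)

record LDigraph (L : Set) : Set where
  field
    n    : ℕ
    edge : Fin n → Fin n → Bool
    lab  : Fin n → L

module _ {L : Set} (G : LDigraph L) where
  open LDigraph G

  Edge : Fin n → Fin n → Set
  Edge u v = edge u v ≡ true

  -- adjacency in the structure S(G) (underlying undirected unlabeled graph)
  Adj : Fin n → Fin n → Set
  Adj u v = Edge u v ⊎ Edge v u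

  -- weakly connected: nonempty and S(G) connected
  WeaklyConnected : Set
  WeaklyConnected = Fin n × ((u v : Fin n) → Star Adj u v)

  -- simple: no self-loops (parallel edges are impossible since D ⊆ V × V)
  Simple : Set
  Simple = (u : Fin n) → edge u u ≡ false

  Oriented : Set
  Oriented = (u v : Fin n) → Edge u v → edge v u ≡ false

  LNode : Set
  LNode = Σ (Fin n × Fin n) (λ p → Edge (proj₁ p) (proj₂ p))

  tail head : LNode → Fin n
  tail e = proj₁ (proj₁ e)
  head e = proj₂ (proj₁ e)

  LLab : LNode → L × L
  LLab e = lab (tail e) , lab (head e)

data ELabel : Set where
  ht tt hh : ELabel

module _ {L : Set} (G : LDigraph L) where
  open LDigraph G

  LEdge : ELabel → LNode G → LNode G → Set
  LEdge ht e ê = e ≢ ê × head G e ≡ tail G ê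
  LEdge tt e ê = e ≢ ê × tail G e ≡ tail G ê
  LEdge hh e ê = e ≢ ê × head G e ≡ head G ê

LineIso : {L : Set} → LDigraph L → LDigraph L → Set
LineIso G G' =
  Σ (LNode G ↔ LNode G') λ f →
    let φ = Inverse.to f in
    ((e : LNode G) → LLab G' (φ e) ≡ LLab G e) ×
    ((l : ELabel) (e ê : LNode G) → LEdge G l e ê ⇔ LEdge G' l (φ e) (φ ê))

StructIso : {L : Set} → LDigraph L → LDigraph L → Set
StructIso G G' =
  Σ (Fin (LDigraph.n G) ↔ Fin (LDigraph.n G')) λ σ →
    let φ = Inverse.to σ in
    (u v : Fin (LDigraph.n G)) → Adj G u v ⇔ Adj G' (φ u) (φ v)

{-# OPTIONS --safe #-}
module Submission where

-- Every vertex of a connected graph with an edge is an endpoint of some edge, and two edge ends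
-- (e , side) and (ê , side') lie on the same vertex exactly when e = ê with the same side or
-- L(G) has the edge labelled hh, tt or ht between them (no self-loops rule out e = ê with
-- different sides). An isomorphism of line digraphs therefore preserves coincidence of edge ends
-- in both directions, and so induces a bijection of vertices sending each edge to an edge.
-- A connected graph without edges has a single vertex, which settles the remaining case.

open import Defs
open import Data.Bool using (true)
import Data.Bool.Properties as Bool
open import Data.Empty using (⊥-elim)
open import Data.Fin using (Fin)
open import Data.Fin.Properties using (any?) renaming (_≟_ to _≟ᶠ_)
open import Data.Product using (∃; _×_; _,_; proj₁; proj₂)
open import Data.Product.Properties using (≡-dec)
open import Data.Sum using (inj₁; inj₂)
import Data.Sum as Sum
open import Function using (_∘_; Inverse; Equivalence; mk⇔; mk↔ₛ′)
open import Relation.Binary.Construct.Closure.ReflexiveTransitive using (Star; ε; _◅_)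
open import Relation.Binary.Definitions using (DecidableEquality)
open import Relation.Binary.PropositionalEquality
open import Relation.Nullary using (¬_; Dec; yes; no)
open import Relation.Nullary.Decidable using (map′)
open import Axiom.UniquenessOfIdentityProofs using (module Decidable⇒UIP)

data Side : Set where
  hd tl : Side

module _ {L : Set} (G : LDigraph L) where
  open LDigraph G

  End : Set
  End = LNode G × Side

  endpoint : End → Fin n
  endpoint (e , hd) = head G e
  endpoint (e , tl) = tail G e

  Incident : Fin n → Set
  Incident v = ∃ λ (a : End) → endpoint a ≡ v

  LNode-≟ : DecidableEquality (LNode G)
  LNode-≟ = ≡-dec (≡-dec _≟ᶠ_ _≟ᶠ_) (λ p q → yes (Decidable⇒UIP.≡-irrelevant Bool._≟_ p q))

  LNode-dec : Dec (LNode G)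
  LNode-dec = map′ (λ (u , v , p) → (u , v) , p) (λ ((u , v) , p) → u , v , p)
                   (any? λ u → any? λ v → edge u v Bool.≟ true)

  Adj⇒LNode : ∀ {u v} → Adj G u v → LNode G
  Adj⇒LNode (inj₁ p) = _ , p
  Adj⇒LNode (inj₂ p) = _ , p

  head≢tail : Simple G → (e : LNode G) → head G e ≢ tail G e
  head≢tail simple ((u , v) , p) refl with trans (sym p) (simple u)
  ... | ()

  incident-◅ : ∀ {v w} → Star (Adj G) v w → Incident w → Incident v
  incident-◅ ε            inc = inc
  incident-◅ (inj₁ p ◅ _) _   = ((_ , p) , tl) , refl
  incident-◅ (inj₂ p ◅ _) _   = ((_ , p) , hd) , refl

  incident-all : WeaklyConnected G → LNode G → (v : Fin n) → Incident v
  incident-all (_ , connected) e v = incident-◅ (connected v (tail G e)) ((e , tl) , refl)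

  edgeless-unique : WeaklyConnected G → ¬ LNode G → (u v : Fin n) → u ≡ v
  edgeless-unique (_ , connected) noEdge u v = unique (connected u v)
    where
    unique : ∀ {x y} → Star (Adj G) x y → x ≡ y
    unique ε       = refl
    unique (p ◅ _) = ⊥-elim (noEdge (Adj⇒LNode p))

LineHom : {L : Set} (G G' : LDigraph L) → (LNode G → LNode G') → Set
LineHom G G' φ = ∀ l e ê → LEdge G l e ê → LEdge G' l (φ e) (φ ê)

module _ {L : Set} {G G' : LDigraph L} where
  open LDigraph using (n)

  mapEnd : (LNode G → LNode G') → End G → End G'
  mapEnd φ (e , s) = φ e , s

  lineHom-preserves-coincidence : Simple G → ∀ {φ} → LineHom G G' φ → ∀ a b →
    endpoint G a ≡ endpoint G b → endpoint G' (mapEnd φ a) ≡ endpoint G' (mapEnd φ b)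
  lineHom-preserves-coincidence simple hom (e , hd) (ê , hd) eq with LNode-≟ G e ê
  ... | yes refl = refl
  ... | no e≢ê   = proj₂ (hom hh e ê (e≢ê , eq))
  lineHom-preserves-coincidence simple hom (e , tl) (ê , tl) eq with LNode-≟ G e ê
  ... | yes refl = refl
  ... | no e≢ê   = proj₂ (hom tt e ê (e≢ê , eq))
  lineHom-preserves-coincidence simple hom (e , hd) (ê , tl) eq =
    proj₂ (hom ht e ê ((λ { refl → head≢tail G simple e eq }) , eq))
  lineHom-preserves-coincidence simple hom (e , tl) (ê , hd) eq =
    sym (proj₂ (hom ht ê e ((λ { refl → head≢tail G simple ê (sym eq) }) , sym eq)))

  inducedMap : (LNode G → LNode G') → ((v : Fin (n G)) → Incident G v) → Fin (n G) → Fin (n G')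
  inducedMap φ incident v = endpoint G' (mapEnd φ (proj₁ (incident v)))

  module _ (simple : Simple G) {φ : LNode G → LNode G'} (hom : LineHom G G' φ)
           (incident : (v : Fin (n G)) → Incident G v) where

    inducedMap-endpoint : ∀ a → inducedMap φ incident (endpoint G a) ≡ endpoint G' (mapEnd φ a)
    inducedMap-endpoint a =
      lineHom-preserves-coincidence simple hom (proj₁ (incident _)) a (proj₂ (incident _))

    inducedMap-edge : ∀ {u v} → Edge G u v →
      Edge G' (inducedMap φ incident u) (inducedMap φ incident v)
    inducedMap-edge p = subst₂ (Edge G') (sym (inducedMap-endpoint (e , tl)))
                                         (sym (inducedMap-endpoint (e , hd))) (proj₂ (φ e))
      where
      e : LNode G
      e = _ , p

    inducedMap-adj : ∀ {u v} → Adj G u v →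
      Adj G' (inducedMap φ incident u) (inducedMap φ incident v)
    inducedMap-adj = Sum.map inducedMap-edge inducedMap-edge

inducedMap-inverse : {L : Set} {G G' : LDigraph L} → Simple G' →
  {φ : LNode G → LNode G'} {ψ : LNode G' → LNode G} → LineHom G' G ψ →
  (incident : (v : Fin (LDigraph.n G)) → Incident G v)
  (incident' : (v : Fin (LDigraph.n G')) → Incident G' v) →
  (∀ e → ψ (φ e) ≡ e) → ∀ v → inducedMap ψ incident' (inducedMap φ incident v) ≡ v
inducedMap-inverse {G = G} simple' {φ} {ψ} hom' incident incident' ψ∘φ v =
  let (e , s) , e-on-v = incident v in begin
    inducedMap ψ incident' (endpoint _ (φ e , s)) ≡⟨ inducedMap-endpoint simple' hom' incident' (φ e , s) ⟩
    endpoint G (ψ (φ e) , s)                      ≡⟨ cong (λ ê → endpoint G (ê , s)) (ψ∘φ e) ⟩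
    endpoint G (e , s)                            ≡⟨ e-on-v ⟩
    v                                             ∎
  where open ≡-Reasoning

module _ {L : Set} {G G' : LDigraph L} where
  open LDigraph using (n)

  lineIso-hom : (iso : LineIso G G') → LineHom G G' (Inverse.to (proj₁ iso))
  lineIso-hom (_ , _ , edges) l e ê = Equivalence.to (edges l e ê)

  lineIso-hom⁻¹ : (iso : LineIso G G') → LineHom G' G (Inverse.from (proj₁ iso))
  lineIso-hom⁻¹ (f , _ , edges) l e ê ℓ =
    Equivalence.from (edges l _ _) (subst₂ (LEdge G' l) (sym (to∘from e)) (sym (to∘from ê)) ℓ)
    where
    to∘from : ∀ e → Inverse.to f (Inverse.from f e) ≡ e
    to∘from = Inverse.strictlyInverseˡ f

  structIso-of-lineIso : Simple G → Simple G' → WeaklyConnected G → WeaklyConnected G' →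
    LNode G → LineIso G G' → StructIso G G'
  structIso-of-lineIso simple simple' wc wc' e iso =
    mk↔ₛ′ f g f∘g g∘f ,
    λ u v → mk⇔ (inducedMap-adj simple hom incident)
                (subst₂ (Adj G) (g∘f u) (g∘f v) ∘ inducedMap-adj simple' hom⁻¹ incident')
    where
    φ : LNode G → LNode G'
    φ = Inverse.to (proj₁ iso)
    ψ : LNode G' → LNode G
    ψ = Inverse.from (proj₁ iso)
    hom : LineHom G G' φ
    hom = lineIso-hom iso
    hom⁻¹ : LineHom G' G ψ
    hom⁻¹ = lineIso-hom⁻¹ iso
    incident : (v : Fin (n G)) → Incident G v
    incident = incident-all G wc e
    incident' : (v : Fin (n G')) → Incident G' v
    incident' = incident-all G' wc' (φ e)
    f : Fin (n G) → Fin (n G')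
    f = inducedMap φ incident
    g : Fin (n G') → Fin (n G)
    g = inducedMap ψ incident'
    f∘g : ∀ v → f (g v) ≡ v
    f∘g = inducedMap-inverse simple hom incident' incident (Inverse.strictlyInverseˡ (proj₁ iso))
    g∘f : ∀ v → g (f v) ≡ v
    g∘f = inducedMap-inverse simple' hom⁻¹ incident incident' (Inverse.strictlyInverseʳ (proj₁ iso))

  structIso-edgeless : WeaklyConnected G → WeaklyConnected G' →
    ¬ LNode G → ¬ LNode G' → StructIso G G'
  structIso-edgeless wc wc' noEdge noEdge' =
    mk↔ₛ′ (λ _ → proj₁ wc') (λ _ → proj₁ wc)
          (edgeless-unique G' wc' noEdge' _) (edgeless-unique G wc noEdge _) ,
    λ _ _ → mk⇔ (⊥-elim ∘ noEdge ∘ Adj⇒LNode G) (⊥-elim ∘ noEdge' ∘ Adj⇒LNode G')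

lemmaA4 : {L : Set} (G G' : LDigraph L) →
    WeaklyConnected G → Simple G → Oriented G →
    WeaklyConnected G' → Simple G' → Oriented G' →
    LineIso G G' → StructIso G G'
lemmaA4 G G' wc simple _ wc' simple' _ iso with LNode-dec G
... | yes e     = structIso-of-lineIso simple simple' wc wc' e iso
... | no noEdge = structIso-edgeless {G = G} {G' = G'} wc wc' noEdge (noEdge ∘ Inverse.from (proj₁ iso))
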